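{- For all positive integers $n,d \ge 2$ there exists a collection $\mathcal{A} \subset \mathcal{P}([n]^d)$ with $|\mathcal{A}| = |\mathcal{P}([n]^d)|/2$ such that there is no pair $(A,B) \in \mathcal{A} \times \mathcal{A}$ satisfying $A \,\Delta\, B = I^d$ for some non-empty interval $I \subset [n]$.
   Context: $[n]=\{1,\dots,n\}$; for integers $a \le b$, $[a,b]=\{a,a+1,\dots,b\}$ is called an interval. $\mathcal{P}(X)$ denotes the power set of $X$, $A\,\Delta\, B$ the symmetric difference, and $I^d = I\times\dots\times I \subset [n]^d$ ($d$ factors). -}

module Defs where

open import Data.Nat using (ℕ)
open import Data.Fin using (Fin; _≤_)
open import Data.Bool using (Bool; T; _xor_)
open import Data.Product using (_×_)
open import Function.Bundles using (_⇔_)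

-- A point of [n]^d: a d-tuple of elements of [n] (Fin n ≅ [n], order preserved).
Point : ℕ → ℕ → Set
Point n d = Fin d → Fin n

-- A subset of [n]^d, given by its (Boolean) characteristic function.
-- Two subsets are equal iff their characteristic functions agree pointwise.
SubsetOf : ℕ → ℕ → Set
SubsetOf n d = Point n d → Bool

_Δ_ : ∀ {n d} → SubsetOf n d → SubsetOf n d → SubsetOf n d
(A Δ B) x = A x xor B x

InCube : ∀ {n d} → Fin n → Fin n → Point n d → Set
InCube a b x = ∀ i → (a ≤ x i) × (x i ≤ b)

SymDiffIsCube : ∀ {n d} → SubsetOf n d → SubsetOf n d → Fin n → Fin n → Set
SymDiffIsCube A B a b = ∀ x → T ((A Δ B) x) ⇔ InCube a b x

-- Let T ⊆ [n]^d consist of the diagonal points (c, c, …, c) and the points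
-- (c+1, c, c+1, …, c+1).  Every cube [a,b]^d meets T in an odd number of
-- points: the diagonal point c+1 and the point (c+1, c, …) lie in the cube
-- together unless c+1 = a, so everything cancels in pairs except the single
-- point (a, …, a).  Hence the parity F(A) = |A ∩ T| mod 2 is a linear map
-- P([n]^d) → 𝔽₂ with F(I^d) = 1, and its kernel 𝒜 — half of all subsets, since
-- the value at (1, …, 1) can be solved for from the others — contains no A, B with A Δ B = I^d,
-- because F(A Δ B) = F(A) + F(B) = 0.

module Submission where

open import Defs
open import Data.Nat using (ℕ; _≤_; _^_; _/_)
open import Data.Fin using (Fin)
open import Data.List using (List; length)
open import Data.List.Membership.Propositional using (_∈_)
open import Data.List.Relation.Unary.AllPairs using (AllPairs)
open import Data.Product using (Σ; _×_)
open import Relation.Binary.PropositionalEquality using (_≡_; _≗_)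
open import Relation.Nullary using (¬_)

open import Algebra.Bundles using (CommutativeRing)
open import Data.Bool using (Bool; true; false; T; _xor_)
open import Data.Bool.Properties using (xor-∧-commutativeRing; xor-same; T-≡; ⇔→≡; ¬-not)
open import Data.Empty using (⊥-elim)
open import Data.Fin using (zero; suc; inject₁; punchIn; punchOut; funToFin; finToFun; _≟_)
  renaming (_≤_ to _≤ᶠ_)
open import Data.Fin.Properties
  using (¬Fin0; <-cmp; <⇒≤pred; <⇒≢; ≤-refl; ≤-reflexive; ≤-antisym; ≤̄⇒inject₁<; i≤inject₁[j]⇒i≤1+j; punchIn-punchOut;
         funToFin-finToFin; finToFun-funToFin)
open import Data.List using ([]; _∷_; map; _++_)
open import Data.List.Properties using (length-map; length-++)
open import Data.List.Relation.Unary.All as All using (All)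
import Data.List.Relation.Unary.All.Properties as All
import Data.List.Relation.Unary.AllPairs as AllPairs
import Data.List.Relation.Unary.AllPairs.Properties as AllPairs
open import Data.Nat using (_+_; z≤n; s≤s)
import Data.Nat.Properties as ℕ
open import Data.Nat.DivMod using (m*n/n≡m)
open import Data.Product using (_,_; proj₁; proj₂)
open import Data.Vec.Functional using (Vector; insertAt) renaming ([] to []ᵛ; _∷_ to _∷ᵛ_)
open import Data.Vec.Functional.Properties using (insertAt-lookup; insertAt-punchIn)
open import Function using (_∘_)
open import Function.Bundles using (_⇔_; mk⇔; Equivalence)
open import Function.Construct.Composition using (_⇔-∘_)
open import Function.Construct.Symmetry using (⇔-sym)
open import Relation.Binary.PropositionalEquality using (refl; sym; trans; cong; cong₂; _≢_; module ≡-Reasoning)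
open import Relation.Binary.Definitions using (tri<; tri≈; tri>)
open import Relation.Nullary using (does; yes; no)
open import Relation.Nullary.Decidable using (dec-true; dec-false)
open ≡-Reasoning

open CommutativeRing xor-∧-commutativeRing using (+-commutativeMonoid; +-commutativeSemigroup)
open import Algebra.Properties.CommutativeSemigroup +-commutativeSemigroup using (interchange)
open import Algebra.Properties.CommutativeMonoid.Sum +-commutativeMonoid
  using (sum-cong-≗; ∑-distrib-+; sum-replicate-zero) renaming (sum to parity)

parity-indicator : ∀ {k} (a : Fin k) → parity (λ c → does (c ≟ a)) ≡ true
parity-indicator {ℕ.suc k} zero    = cong (true xor_) (sum-replicate-zero k)
parity-indicator           (suc a) = parity-indicator a

Distinct : {A B : Set} → List (A → B) → Set
Distinct = AllPairs (λ u w → ¬ u ≗ w)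

map⁺-distinct : {A B C D : Set} {xs : List (A → B)} (f : (A → B) → (C → D)) →
                (∀ u w → f u ≗ f w → u ≗ w) → Distinct xs → Distinct (map f xs)
map⁺-distinct f f-injective =
  AllPairs.map⁺ ∘ AllPairs.map (λ u≉w fu≗fw → u≉w (f-injective _ _ fu≗fw))

allVectors : ∀ m → List (Vector Bool m)
allVectors ℕ.zero    = []ᵛ ∷ []
allVectors (ℕ.suc m) = map (false ∷ᵛ_) (allVectors m) ++ map (true ∷ᵛ_) (allVectors m)

length-allVectors : ∀ m → length (allVectors m) ≡ 2 ^ m
length-allVectors ℕ.zero    = refl
length-allVectors (ℕ.suc m) = begin
  length (map (false ∷ᵛ_) vs ++ map (true ∷ᵛ_) vs)
    ≡⟨ length-++ (map (false ∷ᵛ_) vs) ⟩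
  length (map (false ∷ᵛ_) vs) + length (map (true ∷ᵛ_) vs)
    ≡⟨ cong₂ _+_ (length-map (false ∷ᵛ_) vs) (length-map (true ∷ᵛ_) vs) ⟩
  length vs + length vs
    ≡⟨ cong₂ _+_ (length-allVectors m) (trans (length-allVectors m) (sym (ℕ.+-identityʳ _))) ⟩
  2 ^ ℕ.suc m ∎
  where
  vs = allVectors m

allVectors-distinct : ∀ m → Distinct (allVectors m)
allVectors-distinct ℕ.zero    = All.[] AllPairs.∷ AllPairs.[]
allVectors-distinct (ℕ.suc m) =
  AllPairs.++⁺ (map⁺-distinct (false ∷ᵛ_) tail-injective (allVectors-distinct m))
               (map⁺-distinct (true ∷ᵛ_) tail-injective (allVectors-distinct m))
               (All.map⁺ (All.universal (λ u → All.map⁺ (All.universal (heads-differ u) vs)) vs))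
  where
  tail-injective : ∀ {b} (u w : Vector Bool m) → (b ∷ᵛ u) ≗ (b ∷ᵛ w) → u ≗ w
  tail-injective u w e i = e (suc i)

  vs = allVectors m

  heads-differ : ∀ (u w : Vector Bool m) → ¬ (false ∷ᵛ u) ≗ (true ∷ᵛ w)
  heads-differ u w e with e zero
  ... | ()

insertAt-away : ∀ {A : Set} {m} (xs : Vector A m) {i j : Fin (ℕ.suc m)} (v v′ : A) →
                i ≢ j → insertAt xs i v j ≡ insertAt xs i v′ j
insertAt-away xs {i} {j} v v′ i≢j = begin
  insertAt xs i v  j                          ≡⟨ cong (insertAt xs i v) (punchIn-punchOut i≢j) ⟨
  insertAt xs i v  (punchIn i (punchOut i≢j)) ≡⟨ insertAt-punchIn xs i v _ ⟩
  xs (punchOut i≢j)                           ≡⟨ insertAt-punchIn xs i v′ _ ⟨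
  insertAt xs i v′ (punchIn i (punchOut i≢j)) ≡⟨ cong (insertAt xs i v′) (punchIn-punchOut i≢j) ⟩
  insertAt xs i v′ j                          ∎

2^[1+m]/2≡2^m : ∀ m → 2 ^ ℕ.suc m / 2 ≡ 2 ^ m
2^[1+m]/2≡2^m m = trans (cong (_/ 2) (ℕ.*-comm 2 (2 ^ m))) (m*n/n≡m (2 ^ m) 2)

-- S is free away from p₀, and since R ignores S p₀ the equation fixes exactly that value.
local-equation-solutions :
  ∀ {X : Set} {N} (to : X → Fin N) (from : Fin N → X) → (∀ i → to (from i) ≡ i) →
  (p₀ : X) (R : (X → Bool) → Bool) →
  (∀ S S′ → (∀ x → to x ≢ to p₀ → S x ≡ S′ x) → R S ≡ R S′) →
  Σ (List (X → Bool)) λ 𝒮 → Distinct 𝒮 × length 𝒮 ≡ 2 ^ N / 2 × All (λ S → S p₀ ≡ R S) 𝒮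
local-equation-solutions {N = ℕ.zero} to _ _ p₀ _ _ = ⊥-elim (¬Fin0 (to p₀))
local-equation-solutions {X} {ℕ.suc M} to from to-from p₀ R R-local =
  map solution (allVectors M) ,
  map⁺-distinct solution solution-injective (allVectors-distinct M) ,
  trans (length-map solution (allVectors M))
        (trans (length-allVectors M) (sym (2^[1+m]/2≡2^m M))) ,
  All.map⁺ (All.universal solution-solves (allVectors M))
  where
  extend : Bool → Vector Bool M → X → Bool
  extend v w = insertAt w (to p₀) v ∘ to

  solution : Vector Bool M → X → Bool
  solution w = extend (R (extend false w)) w

  solution-solves : ∀ w → solution w p₀ ≡ R (solution w)
  solution-solves w = trans (insertAt-lookup w (to p₀) _)
    (R-local _ _ (λ x ne → insertAt-away w _ _ (ne ∘ sym)))

  solution-injective : ∀ u w → solution u ≗ solution w → u ≗ w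
  solution-injective u w e k = begin
    u k                                      ≡⟨ insertAt-punchIn u (to p₀) _ k ⟨
    insertAt u (to p₀) _ (punchIn (to p₀) k) ≡⟨ cong (insertAt u (to p₀) _) (to-from _) ⟨
    solution u (from (punchIn (to p₀) k))    ≡⟨ e _ ⟩
    solution w (from (punchIn (to p₀) k))    ≡⟨ cong (insertAt w (to p₀) _) (to-from _) ⟩
    insertAt w (to p₀) _ (punchIn (to p₀) k) ≡⟨ insertAt-punchIn w (to p₀) _ k ⟩
    w k                                      ∎

funToFin-injective : ∀ {m n} {f g : Fin m → Fin n} → funToFin f ≡ funToFin g → f ≗ g
funToFin-injective {f = f} {g} e j =
  trans (sym (finToFun-funToFin f j)) (trans (cong (λ i → finToFun i j) e) (finToFun-funToFin g j))

module _ {n d : ℕ} where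

  private
    Pt = Point (ℕ.suc n) (ℕ.suc (ℕ.suc d))

  diagonal : Fin (ℕ.suc n) → Pt
  diagonal c _ = c

  offDiagonal : Fin n → Pt
  offDiagonal c zero          = suc c
  offDiagonal c (suc zero)    = inject₁ c
  offDiagonal c (suc (suc _)) = suc c

  testPairs : SubsetOf (ℕ.suc n) (ℕ.suc (ℕ.suc d)) → Vector Bool (ℕ.suc n)
  testPairs S zero    = S (diagonal zero)
  testPairs S (suc c) = S (diagonal (suc c)) xor S (offDiagonal c)

  testParity : SubsetOf (ℕ.suc n) (ℕ.suc (ℕ.suc d)) → Bool
  testParity S = parity (testPairs S)

  testParity-Δ : ∀ A B → testParity (A Δ B) ≡ testParity A xor testParity B
  testParity-Δ A B = trans (sum-cong-≗ pairs-Δ) (∑-distrib-+ (testPairs A) (testPairs B))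
    where
    pairs-Δ : ∀ c → testPairs (A Δ B) c ≡ testPairs A c xor testPairs B c
    pairs-Δ zero    = refl
    pairs-Δ (suc c) = interchange (A (diagonal (suc c))) (B (diagonal (suc c)))
                                  (A (offDiagonal c)) (B (offDiagonal c))

  -- testParity S reduces to S (diagonal zero) xor offParity S.
  offParity : SubsetOf (ℕ.suc n) (ℕ.suc (ℕ.suc d)) → Bool
  offParity S = parity (testPairs S ∘ suc)

  offParity-local : ∀ S S′ → (∀ x → funToFin x ≢ funToFin (diagonal zero) → S x ≡ S′ x) →
                    offParity S ≡ offParity S′
  offParity-local S S′ agree = sum-cong-≗ λ c →
    cong₂ _xor_ (agree (diagonal (suc c)) (away {diagonal (suc c)} refl))
                (agree (offDiagonal c) (away {offDiagonal c} refl))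
    where
    away : ∀ {x : Pt} {c} → x zero ≡ suc c → funToFin x ≢ funToFin (diagonal zero)
    away {x} x₀≡suc e with trans (sym x₀≡suc) (funToFin-injective {f = x} {g = diagonal zero} e zero)
    ... | ()

  module _ {D : SubsetOf (ℕ.suc n) (ℕ.suc (ℕ.suc d))} {a b : Fin (ℕ.suc n)}
           (a≤b : a ≤ᶠ b) (D-cube : ∀ x → T (D x) ⇔ InCube a b x) where

    private
      in-cube : ∀ {x} → InCube a b x → D x ≡ true
      in-cube {x} = Equivalence.to T-≡ ∘ Equivalence.from (D-cube x)

      out-of-cube : ∀ {x} → ¬ InCube a b x → D x ≡ false
      out-of-cube {x} ∉ = ¬-not (∉ ∘ Equivalence.to (D-cube x) ∘ Equivalence.from T-≡)

      same-membership : ∀ {x y} → InCube a b x ⇔ InCube a b y → D x ≡ D y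
      same-membership {x} {y} x⇔y =
        ⇔→≡ (T-≡ ⇔-∘ (⇔-sym (D-cube y) ⇔-∘ (x⇔y ⇔-∘ (D-cube x ⇔-∘ ⇔-sym T-≡))))

      diagonal-∈ : ∀ {c} → a ≤ᶠ c → c ≤ᶠ b → InCube a b (diagonal c)
      diagonal-∈ a≤c c≤b _ = a≤c , c≤b

      offDiagonal-∈ : ∀ {c} → a ≤ᶠ inject₁ c → suc c ≤ᶠ b → InCube a b (offDiagonal c)
      offDiagonal-∈ a≤c 1+c≤b zero          = i≤inject₁[j]⇒i≤1+j a≤c , 1+c≤b
      offDiagonal-∈ a≤c 1+c≤b (suc zero)    = a≤c , ℕ.<⇒≤ (ℕ.<-≤-trans (≤̄⇒inject₁< ≤-refl) 1+c≤b)
      offDiagonal-∈ a≤c 1+c≤b (suc (suc _)) = i≤inject₁[j]⇒i≤1+j a≤c , 1+c≤b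

    testPairs-cube : ∀ c → testPairs D c ≡ does (c ≟ a)
    testPairs-cube zero with zero ≟ a
    ... | yes 0≡a = in-cube (diagonal-∈ (≤-reflexive (sym 0≡a)) z≤n)
    ... | no 0≢a  = out-of-cube (λ ∈ → 0≢a (≤-antisym z≤n (proj₁ (∈ zero))))
    testPairs-cube (suc c) with <-cmp a (suc c)
    ... | tri< a<c _ _ = trans (cong (_xor D (offDiagonal c)) (same-membership diagonal⇔offDiagonal))
                               (trans (xor-same (D (offDiagonal c))) (sym (dec-false (suc c ≟ a) (<⇒≢ a<c ∘ sym))))
      where
      diagonal⇔offDiagonal : InCube a b (diagonal (suc c)) ⇔ InCube a b (offDiagonal c)
      diagonal⇔offDiagonal = mk⇔ (λ ∈ → offDiagonal-∈ (<⇒≤pred a<c) (proj₂ (∈ zero)))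
                                 (λ ∈ → diagonal-∈ (ℕ.<⇒≤ a<c) (proj₂ (∈ zero)))
    ... | tri≈ _ refl _ = trans (cong₂ _xor_ (in-cube (diagonal-∈ ≤-refl a≤b))
                                             (out-of-cube (λ ∈ → ℕ.<⇒≱ (≤̄⇒inject₁< ≤-refl) (proj₁ (∈ (suc zero))))))
                                (sym (dec-true (suc c ≟ suc c) refl))
    ... | tri> _ _ c<a = trans (cong₂ _xor_ (out-of-cube (λ ∈ → ℕ.<⇒≱ c<a (proj₁ (∈ zero))))
                                            (out-of-cube (λ ∈ → ℕ.<⇒≱ c<a (proj₁ (∈ zero)))))
                               (sym (dec-false (suc c ≟ a) (<⇒≢ c<a)))

    testParity-cube : testParity D ≡ true
    testParity-cube = trans (sum-cong-≗ testPairs-cube) (parity-indicator a)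

  testParity-even : ∀ {S} → S (diagonal zero) ≡ offParity S → testParity S ≡ false
  testParity-even {S} S₀≡ = trans (cong (_xor offParity S) S₀≡) (xor-same (offParity S))

  cube-not-Δ-of-even : ∀ {A B} → testParity A ≡ false → testParity B ≡ false →
                       ∀ {a b} → a ≤ᶠ b → ¬ SymDiffIsCube A B a b
  cube-not-Δ-of-even {A} {B} A-even B-even a≤b cube = true≢false (begin
    true                              ≡⟨ testParity-cube {D = A Δ B} a≤b cube ⟨
    testParity (A Δ B)                ≡⟨ testParity-Δ A B ⟩
    testParity A xor testParity B     ≡⟨ cong₂ _xor_ A-even B-even ⟩
    false                             ∎)
    where
    true≢false : true ≢ false
    true≢false ()

theorem2p1 : (n d : ℕ) → 2 ≤ n → 2 ≤ d →
    Σ (List (SubsetOf n d)) λ 𝒜 →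
      AllPairs (λ A B → ¬ (A ≗ B)) 𝒜
      × length 𝒜 ≡ (2 ^ (n ^ d)) / 2
      × (∀ {A B} → A ∈ 𝒜 → B ∈ 𝒜 → (a b : Fin n) → a Data.Fin.≤ b → ¬ SymDiffIsCube A B a b)
theorem2p1 ℕ.zero _ () _
theorem2p1 _ ℕ.zero _ ()
theorem2p1 _ (ℕ.suc ℕ.zero) _ (s≤s ())
theorem2p1 (ℕ.suc n) (ℕ.suc (ℕ.suc d)) _ _ =
  let 𝒜 , distinct , size , solved =
        local-equation-solutions funToFin finToFun (funToFin-finToFin {ℕ.suc (ℕ.suc d)} {ℕ.suc n})
                                 (diagonal zero) offParity offParity-local
  in  𝒜 , distinct , size , λ {A} {B} A∈𝒜 B∈𝒜 _ _ →
        cube-not-Δ-of-even {A = A} {B} (testParity-even {S = A} (All.lookup solved A∈𝒜))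
                                       (testParity-even {S = B} (All.lookup solved B∈𝒜))
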